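{- Let $\mathcal{G}=(\mathcal{V},\mathcal{E})$ be a triangle-free graph and let $\alpha,\beta$ be positive integers with $\alpha\beta=|\mathcal{E}|$. If $\{(A_v\mid B_v): v\in\mathcal{V}\}$ is an $(\alpha\mid\beta)$-cointersection representation of $\mathcal{G}$, then $|A_v|\,|B_v|=\deg(v)$ for every $v\in\mathcal{V}$, and $|A_u\cap A_v|=|B_u\cap B_v|=1$ for every edge $(u,v)\in\mathcal{E}$.
   Context: Graphs are finite, simple and undirected. For a graph $\mathcal{G}=(\mathcal{V},\mathcal{E})$ and positive integers $\alpha,\beta$, an $(\alpha\mid\beta)$-cointersection representation of $\mathcal{G}$ consists of two disjoint finite sets of features $\mathcal{A},\mathcal{B}$ with $|\mathcal{A}|=\alpha$, $|\mathcal{B}|=\beta$, together with an assignment to each vertex $v$ of subsets $A_v\subseteq\mathcal{A}$, $B_v\subseteq\mathcal{B}$ (possibly empty), such that for all distinct $u,v\in\mathcal{V}$: $(u,v)\in\mathcal{E}$ if and only if $A_u\cap A_v\neq\varnothing$ and $B_u\cap B_v\neq\varnothing$. -}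

module Defs where

open import Data.Nat using (ℕ; _<ᵇ_)
open import Data.Nat.ListAction using (sum)
open import Data.Bool using (Bool; true; false; _∧_)
open import Data.Fin using (Fin; toℕ)
open import Data.Fin.Subset using (Subset; _∩_; ∣_∣; Nonempty)
open import Data.List using (List; map)
open import Data.List.Base using (allFin)
open import Data.Vec using (tabulate)
open import Data.Empty using (⊥)
open import Data.Product using (_×_)
open import Relation.Binary.PropositionalEquality using (_≡_; _≢_)
open import Function.Bundles using (_⇔_)

record Graph (n : ℕ) : Set where
  field
    adj    : Fin n → Fin n → Bool
    sym    : ∀ u v → adj u v ≡ adj v u
    irrefl : ∀ v → adj v v ≡ false
open Graph public

module _ {n : ℕ} (G : Graph n) where

  nbhd : Fin n → Subset n
  nbhd v = tabulate (adj G v)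

  degree : Fin n → ℕ
  degree v = ∣ nbhd v ∣

  numEdges : ℕ
  numEdges = sum (map (λ u → ∣ tabulate (λ v → adj G u v ∧ (toℕ u <ᵇ toℕ v)) ∣) (allFin n))

  TriangleFree : Set
  TriangleFree = ∀ u v w → adj G u v ≡ true → adj G v w ≡ true → adj G u w ≡ true → ⊥

  -- (α | β)-cointersection representation: feature sets Fin α and Fin β
  -- (disjoint by construction), A v ⊆ Fin α, B v ⊆ Fin β.
  record CointersectionRep (α β : ℕ) : Set where
    field
      A       : Fin n → Subset α
      B       : Fin n → Subset β
      correct : ∀ u v → u ≢ v →
                (adj G u v ≡ true) ⇔ (Nonempty (A u ∩ A v) × Nonempty (B u ∩ B v))
  open CointersectionRep public

module Submission where

-- Call a pair of features (a , b) ∈ Fin α × Fin β a *cell*,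
-- and say that v lies in the cell when a ∈ A v and b ∈ B v.  Any two
-- distinct vertices of a common cell are adjacent, so every cell is a
-- clique; in a triangle-free graph a clique has at most two vertices and
-- every vertex has at most one neighbour inside a given clique.
--
-- For a vertex v let  shared v = Σ_w [v ~ w] · |A v ∩ A w| · |B v ∩ B w|,
-- the number of pairs (neighbour w, cell containing both v and w).  Then
--   deg v ≤ shared v               (every edge lies in some cell),
--   shared v ≤ |A v| · |B v|       (v has ≤ 1 neighbour in each of its cells),
--   Σ_v |A v| |B v| = Σ_cells |cell| ≤ 2αβ = 2|E| = Σ_v deg v.
-- A chain of pointwise inequalities whose totals are reversed collapses to
-- pointwise equalities: deg v = |A v| |B v|, and the edge terms of
-- deg v = shared v force |A u ∩ A v| · |B u ∩ B v| = 1 on every edge.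

open import Defs
open import Data.Nat using (ℕ; zero; suc; _+_; _*_; _≤_; _<_; z≤n; s≤s; _<ᵇ_)
open import Data.Nat.Properties
  using ( +-*-semiring; *-commutativeSemigroup; _<?_; <-cmp
        ; ≤-trans; ≤-antisym; ≤-reflexive; module ≤-Reasoning
        ; +-mono-≤; +-monoˡ-≤; +-monoʳ-≤; +-cancelˡ-≤; +-cancelʳ-≤
        ; *-mono-≤; *-monoʳ-≤; *-assoc; *-comm; *-identityʳ; +-identityʳ
        ; m*n≡1⇒m≡1; m*n≡1⇒n≡1 )
open import Data.Nat.ListAction using () renaming (sum to listSum)
open import Data.Bool using (Bool; true; false; _∧_)
open import Data.Bool.Properties using (∧-identityʳ; ∧-zeroʳ)
open import Data.Fin using (Fin; zero; suc; toℕ)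
open import Data.Fin.Properties using (_≟_; 0≢1+n; suc-injective; toℕ-injective)
open import Data.Fin.Subset using (Subset; _∩_; _∈_; ∣_∣; Nonempty)
open import Data.Fin.Subset.Properties using (x∈p∩q⁺; x∈⁅y⁆⇒x≡y; ∣⁅x⁆∣≡1; p⊆q⇒∣p∣≤∣q∣)
open import Data.List.Base using () renaming (map to listMap; tabulate to listTabulate)
open import Data.Vec using ([]; _∷_; lookup; tabulate)
open import Data.Vec.Properties using (lookup⇒[]=; lookup-zipWith; lookup∘tabulate)
open import Data.Product using (_×_; _,_; proj₁; proj₂)
open import Data.Empty using (⊥; ⊥-elim)
open import Function using (_∘_)
open import Function.Bundles using (Equivalence)
open import Relation.Nullary using (¬_; yes; no)
open import Relation.Nullary.Decidable using (dec-true; dec-false)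
open import Relation.Binary using (tri<; tri≈; tri>)
open import Relation.Binary.PropositionalEquality as ≡
  using (_≡_; _≢_; refl; cong; cong₂; trans; subst; module ≡-Reasoning)
open import Algebra.Properties.Semiring.Sum +-*-semiring
  using (sum; sum-syntax; sum-cong-≗; ∑-comm; ∑-distrib-+; *-distribˡ-sum; *-distribʳ-sum)
open import Algebra.Properties.CommutativeSemigroup *-commutativeSemigroup
  using (x∙yz≈y∙xz)

sum-const : ∀ n k → ∑[ i < n ] k ≡ n * k
sum-const zero    k = refl
sum-const (suc n) k = cong (k +_) (sum-const n k)

sum-mono : ∀ {n} {f g : Fin n → ℕ} → (∀ i → f i ≤ g i) → sum f ≤ sum g
sum-mono {zero}  f≤g = z≤n
sum-mono {suc n} f≤g = +-mono-≤ (f≤g zero) (sum-mono (f≤g ∘ suc))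

sum-squeeze : ∀ {n} {f g : Fin n → ℕ} → (∀ i → f i ≤ g i) → sum g ≤ sum f →
              ∀ i → f i ≡ g i
sum-squeeze {suc n} {f} {g} f≤g total zero =
  ≤-antisym (f≤g zero)
    (+-cancelʳ-≤ _ _ _ (≤-trans total (+-monoʳ-≤ (f zero) (sum-mono (f≤g ∘ suc)))))
sum-squeeze {suc n} {f} {g} f≤g total (suc i) =
  sum-squeeze (f≤g ∘ suc)
    (+-cancelˡ-≤ (g zero) _ _ (≤-trans total (+-monoˡ-≤ (sum (f ∘ suc)) (f≤g zero)))) i

sandwich : ∀ {n} {f g h : Fin n → ℕ} → (∀ i → f i ≤ g i) → (∀ i → g i ≤ h i) →
           sum h ≤ sum f → ∀ i → f i ≡ g i × g i ≡ h i
sandwich f≤g g≤h total i =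
  sum-squeeze f≤g (≤-trans (sum-mono g≤h) total) i ,
  sum-squeeze g≤h (≤-trans total (sum-mono f≤g)) i

∑-comm₃ : ∀ {m p q} (f : Fin m → Fin p → Fin q → ℕ) →
          ∑[ i < m ] ∑[ j < p ] ∑[ k < q ] f i j k ≡ ∑[ j < p ] ∑[ k < q ] ∑[ i < m ] f i j k
∑-comm₃ f = trans (∑-comm (λ i j → sum (f i j))) (sum-cong-≗ (λ j → ∑-comm (λ i k → f i j k)))

sum-product : ∀ {m p} (f : Fin m → ℕ) (g : Fin p → ℕ) →
              sum f * sum g ≡ ∑[ i < m ] ∑[ j < p ] (f i * g j)
sum-product f g = trans (*-distribʳ-sum (sum g) f) (sum-cong-≗ (λ i → *-distribˡ-sum (f i) g))

-- Exchanging a weighted outer sum with an inner double sum; this is the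
-- double counting of (neighbour, cell) pairs in `shared≤cells`.
sum-pull : ∀ {m p q} (c : Fin m → ℕ) (x : Fin p → Fin q → ℕ) (y : Fin p → Fin q → Fin m → ℕ) →
           ∑[ w < m ] (c w * ∑[ a < p ] ∑[ b < q ] (x a b * y a b w))
           ≡ ∑[ a < p ] ∑[ b < q ] (x a b * ∑[ w < m ] (c w * y a b w))
sum-pull c x y = begin
  ∑[ w < _ ] (c w * ∑[ a < _ ] ∑[ b < _ ] (x a b * y a b w))
    ≡⟨ sum-cong-≗ (λ w → trans (*-distribˡ-sum (c w) (λ a → ∑[ b < _ ] (x a b * y a b w)))
                                (sum-cong-≗ (λ a → *-distribˡ-sum (c w) (λ b → x a b * y a b w)))) ⟩
  ∑[ w < _ ] ∑[ a < _ ] ∑[ b < _ ] (c w * (x a b * y a b w))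
    ≡⟨ ∑-comm₃ (λ w a b → c w * (x a b * y a b w)) ⟩
  ∑[ a < _ ] ∑[ b < _ ] ∑[ w < _ ] (c w * (x a b * y a b w))
    ≡⟨ sum-cong-≗ (λ a → sum-cong-≗ (λ b → sum-cong-≗ (λ w → x∙yz≈y∙xz (c w) (x a b) (y a b w)))) ⟩
  ∑[ a < _ ] ∑[ b < _ ] ∑[ w < _ ] (x a b * (c w * y a b w))
    ≡⟨ sum-cong-≗ (λ a → sum-cong-≗ (λ b → ≡.sym (*-distribˡ-sum (x a b) (λ w → c w * y a b w)))) ⟩
  ∑[ a < _ ] ∑[ b < _ ] (x a b * ∑[ w < _ ] (c w * y a b w))
    ∎
  where open ≡-Reasoning

listSum-tabulate : ∀ {A : Set} {n} (h : A → ℕ) (g : Fin n → A) →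
                   listSum (listMap h (listTabulate g)) ≡ ∑[ i < n ] h (g i)
listSum-tabulate {n = zero}  h g = refl
listSum-tabulate {n = suc n} h g = cong (h (g zero) +_) (listSum-tabulate h (g ∘ suc))

⟦_⟧ : Bool → ℕ
⟦ true  ⟧ = 1
⟦ false ⟧ = 0

⟦∧⟧ : ∀ x y → ⟦ x ∧ y ⟧ ≡ ⟦ x ⟧ * ⟦ y ⟧
⟦∧⟧ true  y = ≡.sym (+-identityʳ ⟦ y ⟧)
⟦∧⟧ false y = refl

⟦∧⟧-interchange : ∀ x y z w → ⟦ (x ∧ y) ∧ (z ∧ w) ⟧ ≡ ⟦ x ∧ z ⟧ * ⟦ y ∧ w ⟧
⟦∧⟧-interchange false y     z     w = refl
⟦∧⟧-interchange true  false true  w = refl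
⟦∧⟧-interchange true  false false w = refl
⟦∧⟧-interchange true  true  z     w = ⟦∧⟧ z w

∧-true : ∀ {x y} → x ∧ y ≡ true → x ≡ true × y ≡ true
∧-true {true}  y≡true = refl , y≡true
∧-true {false} ()

count : ∀ {n} → (Fin n → Bool) → ℕ
count p = sum (⟦_⟧ ∘ p)

AtMostOne : ∀ {n} → (Fin n → Bool) → Set
AtMostOne p = ∀ i j → p i ≡ true → p j ≡ true → i ≡ j

NoThree : ∀ {n} → (Fin n → Bool) → Set
NoThree p = ∀ i j k → i ≢ j → j ≢ k → i ≢ k → p i ≡ true → p j ≡ true → p k ≡ true → ⊥

count-none : ∀ {n} (p : Fin n → Bool) → (∀ i → p i ≢ true) → count p ≡ 0
count-none {zero}  p none = refl
count-none {suc n} p none with p zero in p₀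
... | true  = ⊥-elim (none zero p₀)
... | false = count-none (p ∘ suc) (none ∘ suc)

count-≤1 : ∀ {n} (p : Fin n → Bool) → AtMostOne p → count p ≤ 1
count-≤1 {zero}  p one = z≤n
count-≤1 {suc n} p one with p zero in p₀
... | true  = ≤-reflexive (cong suc (count-none (p ∘ suc) (λ i pᵢ → 0≢1+n (one zero (suc i) p₀ pᵢ))))
... | false = count-≤1 (p ∘ suc) (λ i j pᵢ pⱼ → suc-injective (one (suc i) (suc j) pᵢ pⱼ))

count-≤2 : ∀ {n} (p : Fin n → Bool) → NoThree p → count p ≤ 2
count-≤2 {zero}  p noThree = z≤n
count-≤2 {suc n} p noThree with p zero in p₀
... | true  = s≤s (count-≤1 (p ∘ suc) atMostOneMore)
  where
  atMostOneMore : AtMostOne (p ∘ suc)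
  atMostOneMore i j pᵢ pⱼ with i ≟ j
  ... | yes i≡j = i≡j
  ... | no  i≢j = ⊥-elim (noThree zero (suc i) (suc j) 0≢1+n (i≢j ∘ suc-injective) 0≢1+n p₀ pᵢ pⱼ)
... | false = count-≤2 (p ∘ suc) (λ i j k i≢j j≢k i≢k →
                noThree (suc i) (suc j) (suc k)
                  (i≢j ∘ suc-injective) (j≢k ∘ suc-injective) (i≢k ∘ suc-injective))

card-count : ∀ {n} (p : Subset n) → ∣ p ∣ ≡ count (lookup p)
card-count []          = refl
card-count (true  ∷ p) = cong suc (card-count p)
card-count (false ∷ p) = card-count p

card-tabulate : ∀ {n} (f : Fin n → Bool) → ∣ tabulate f ∣ ≡ count f
card-tabulate f = trans (card-count (tabulate f)) (sum-cong-≗ (λ i → cong ⟦_⟧ (lookup∘tabulate f i)))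

card-product : ∀ {m k} (p : Subset m) (q : Subset k) →
               ∣ p ∣ * ∣ q ∣ ≡ ∑[ a < m ] ∑[ b < k ] ⟦ lookup p a ∧ lookup q b ⟧
card-product p q = begin
  ∣ p ∣ * ∣ q ∣                                          ≡⟨ cong₂ _*_ (card-count p) (card-count q) ⟩
  count (lookup p) * count (lookup q)                    ≡⟨ sum-product (⟦_⟧ ∘ lookup p) (⟦_⟧ ∘ lookup q) ⟩
  ∑[ a < _ ] ∑[ b < _ ] (⟦ lookup p a ⟧ * ⟦ lookup q b ⟧) ≡⟨ sum-cong-≗ (λ a → sum-cong-≗ (λ b → ≡.sym (⟦∧⟧ (lookup p a) (lookup q b)))) ⟩
  ∑[ a < _ ] ∑[ b < _ ] ⟦ lookup p a ∧ lookup q b ⟧      ∎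
  where open ≡-Reasoning

nonempty-card : ∀ {n} {p : Subset n} → Nonempty p → 1 ≤ ∣ p ∣
nonempty-card {p = p} (x , x∈p) =
  subst (_≤ ∣ p ∣) (∣⁅x⁆∣≡1 x) (p⊆q⇒∣p∣≤∣q∣ (λ y∈⁅x⁆ → subst (_∈ p) (≡.sym (x∈⁅y⁆⇒x≡y x y∈⁅x⁆)) x∈p))

∈∩-lookup : ∀ {n} {p q : Subset n} i → lookup p i ≡ true → lookup q i ≡ true → i ∈ p ∩ q
∈∩-lookup {p = p} {q} i i∈p i∈q = x∈p∩q⁺ (lookup⇒[]= i p i∈p , lookup⇒[]= i q i∈q)

<ᵇ-true : ∀ {m k} → m < k → (m <ᵇ k) ≡ true
<ᵇ-true {m} {k} = dec-true (m <? k)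

<ᵇ-false : ∀ {m k} → ¬ m < k → (m <ᵇ k) ≡ false
<ᵇ-false {m} {k} = dec-false (m <? k)

module _ {n : ℕ} (G : Graph n) where

  degree-count : ∀ v → degree G v ≡ count (adj G v)
  degree-count v = card-tabulate (adj G v)

  adj⇒≢ : ∀ {u v} → adj G u v ≡ true → u ≢ v
  adj⇒≢ {u} uv refl with trans (≡.sym uv) (irrefl G u)
  ... | ()

  lowEdge : Fin n → Fin n → Bool
  lowEdge u v = adj G u v ∧ (toℕ u <ᵇ toℕ v)

  adj-split : ∀ u v → ⟦ adj G u v ⟧ ≡ ⟦ lowEdge u v ⟧ + ⟦ lowEdge v u ⟧
  adj-split u v with <-cmp (toℕ u) (toℕ v)
  ... | tri< u<v _ v≮u
    rewrite <ᵇ-true u<v | <ᵇ-false v≮u | ∧-identityʳ (adj G u v) | ∧-zeroʳ (adj G v u) =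
      ≡.sym (+-identityʳ _)
  ... | tri≈ _ u≡v _ with toℕ-injective u≡v
  ...   | refl rewrite irrefl G u = refl
  adj-split u v | tri> u≮v _ v<u
    rewrite <ᵇ-false u≮v | <ᵇ-true v<u | ∧-zeroʳ (adj G u v) | ∧-identityʳ (adj G v u) =
      cong ⟦_⟧ (Graph.sym G u v)

  numEdges-count : numEdges G ≡ ∑[ u < n ] count (lowEdge u)
  numEdges-count = trans (listSum-tabulate (λ u → ∣ tabulate (lowEdge u) ∣) (λ u → u))
                         (sum-cong-≗ (λ u → card-tabulate (lowEdge u)))

  handshake : ∑[ v < n ] degree G v ≡ 2 * numEdges G
  handshake = begin
    ∑[ u < n ] degree G u                                       ≡⟨ sum-cong-≗ degree-count ⟩
    ∑[ u < n ] ∑[ v < n ] ⟦ adj G u v ⟧                         ≡⟨ sum-cong-≗ (λ u → sum-cong-≗ (adj-split u)) ⟩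
    ∑[ u < n ] ∑[ v < n ] (⟦ lowEdge u v ⟧ + ⟦ lowEdge v u ⟧)   ≡⟨ sum-cong-≗ (λ u → ∑-distrib-+ (⟦_⟧ ∘ lowEdge u) (λ v → ⟦ lowEdge v u ⟧)) ⟩
    ∑[ u < n ] (count (lowEdge u) + ∑[ v < n ] ⟦ lowEdge v u ⟧) ≡⟨ ∑-distrib-+ (count ∘ lowEdge) (λ u → ∑[ v < n ] ⟦ lowEdge v u ⟧) ⟩
    E + ∑[ u < n ] ∑[ v < n ] ⟦ lowEdge v u ⟧                   ≡⟨ cong (E +_) (∑-comm (λ u v → ⟦ lowEdge v u ⟧)) ⟩
    E + E                                                       ≡⟨ cong (E +_) (≡.sym (+-identityʳ E)) ⟩
    2 * E                                                       ≡⟨ cong (2 *_) numEdges-count ⟨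
    2 * numEdges G                                              ∎
    where
    open ≡-Reasoning
    E : ℕ
    E = ∑[ u < n ] count (lowEdge u)

  IsClique : (Fin n → Bool) → Set
  IsClique p = ∀ u v → u ≢ v → p u ≡ true → p v ≡ true → adj G u v ≡ true

  module _ (triangleFree : TriangleFree G) {p : Fin n → Bool} (clique : IsClique p) where

    clique-size : count p ≤ 2
    clique-size = count-≤2 p (λ u v w u≢v v≢w u≢w pu pv pw →
      triangleFree u v w (clique u v u≢v pu pv) (clique v w v≢w pv pw) (clique u w u≢w pu pw))

    clique-neighbours : ∀ v → count (λ w → adj G v w ∧ p w) ≤ 1
    clique-neighbours v = count-≤1 _ unique
      where
      unique : AtMostOne (λ w → adj G v w ∧ p w)
      unique w w′ vw∧pw vw′∧pw′ with ∧-true vw∧pw | ∧-true vw′∧pw′ | w ≟ w′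
      ... | _        | _          | yes w≡w′ = w≡w′
      ... | vw , pw | vw′ , pw′ | no  w≢w′ = ⊥-elim (triangleFree v w w′ vw (clique w w′ w≢w′ pw pw′) vw′)

module Cells {n : ℕ} (G : Graph n) {α β : ℕ} (R : CointersectionRep G α β) where

  inCell : Fin α → Fin β → Fin n → Bool
  inCell a b v = lookup (A R v) a ∧ lookup (B R v) b

  -- Vertices sharing a cell share a feature of each kind, hence are adjacent.
  cell-clique : ∀ a b → IsClique G (inCell a b)
  cell-clique a b u v u≢v u∈ab v∈ab with ∧-true u∈ab | ∧-true v∈ab
  ... | a∈Au , b∈Bu | a∈Av , b∈Bv =
    Equivalence.from (correct R u v u≢v) ((a , ∈∩-lookup a a∈Au a∈Av) , (b , ∈∩-lookup b b∈Bu b∈Bv))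

  -- Number of cells containing both u and v.
  common : Fin n → Fin n → ℕ
  common u v = ∣ A R u ∩ A R v ∣ * ∣ B R u ∩ B R v ∣

  common-cells : ∀ u v → common u v ≡ ∑[ a < α ] ∑[ b < β ] (⟦ inCell a b u ⟧ * ⟦ inCell a b v ⟧)
  common-cells u v = trans (card-product (A R u ∩ A R v) (B R u ∩ B R v))
    (sum-cong-≗ (λ a → sum-cong-≗ (λ b →
      trans (cong₂ (λ x y → ⟦ x ∧ y ⟧) (lookup-zipWith _∧_ a (A R u) (A R v))
                                       (lookup-zipWith _∧_ b (B R u) (B R v)))
            (⟦∧⟧-interchange (lookup (A R u) a) (lookup (A R v) a) (lookup (B R u) b) (lookup (B R v) b)))))

  edge-common : ∀ {u v} → adj G u v ≡ true → 1 ≤ common u v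
  edge-common {u} {v} uv with Equivalence.to (correct R u v (adj⇒≢ G uv)) uv
  ... | shareA , shareB = *-mono-≤ (nonempty-card shareA) (nonempty-card shareB)

  shared : Fin n → ℕ
  shared v = ∑[ w < n ] (⟦ adj G v w ⟧ * common v w)

  edge-term : ∀ v w → ⟦ adj G v w ⟧ ≤ ⟦ adj G v w ⟧ * common v w
  edge-term v w with adj G v w in vw
  ... | true  = subst (1 ≤_) (≡.sym (+-identityʳ _)) (edge-common vw)
  ... | false = z≤n

  degree≤shared : ∀ v → degree G v ≤ shared v
  degree≤shared v = ≤-trans (≤-reflexive (degree-count G v)) (sum-mono (edge-term v))

  edge-common-one : ∀ {u v} → degree G u ≡ shared u → adj G u v ≡ true → common u v ≡ 1
  edge-common-one {u} {v} deg≡shared uv =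
    trans (≡.sym (+-identityʳ _)) (≡.sym (subst (λ x → ⟦ x ⟧ ≡ ⟦ x ⟧ * common u v) uv termEq))
    where
    termEq : ⟦ adj G u v ⟧ ≡ ⟦ adj G u v ⟧ * common u v
    termEq = sum-squeeze (edge-term u)
               (≤-reflexive (≡.sym (trans (≡.sym (degree-count G u)) deg≡shared))) v

  module _ (triangleFree : TriangleFree G) where

    -- In each of its cells v has at most one neighbour.
    shared≤cells : ∀ v → shared v ≤ ∣ A R v ∣ * ∣ B R v ∣
    shared≤cells v = begin
      ∑[ w < n ] (⟦ adj G v w ⟧ * common v w)
        ≡⟨ sum-cong-≗ (λ w → cong (⟦ adj G v w ⟧ *_) (common-cells v w)) ⟩
      ∑[ w < n ] (⟦ adj G v w ⟧ * ∑[ a < α ] ∑[ b < β ] (⟦ inCell a b v ⟧ * ⟦ inCell a b w ⟧))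
        ≡⟨ sum-pull (⟦_⟧ ∘ adj G v) (λ a b → ⟦ inCell a b v ⟧) (λ a b w → ⟦ inCell a b w ⟧) ⟩
      ∑[ a < α ] ∑[ b < β ] (⟦ inCell a b v ⟧ * ∑[ w < n ] (⟦ adj G v w ⟧ * ⟦ inCell a b w ⟧))
        ≤⟨ sum-mono (λ a → sum-mono (λ b → *-monoʳ-≤ ⟦ inCell a b v ⟧ (neighboursInCell a b))) ⟩
      ∑[ a < α ] ∑[ b < β ] (⟦ inCell a b v ⟧ * 1)
        ≡⟨ sum-cong-≗ (λ a → sum-cong-≗ (λ b → *-identityʳ ⟦ inCell a b v ⟧)) ⟩
      ∑[ a < α ] ∑[ b < β ] ⟦ inCell a b v ⟧
        ≡⟨ card-product (A R v) (B R v) ⟨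
      ∣ A R v ∣ * ∣ B R v ∣
        ∎
      where
      open ≤-Reasoning
      neighboursInCell : ∀ a b → ∑[ w < n ] (⟦ adj G v w ⟧ * ⟦ inCell a b w ⟧) ≤ 1
      neighboursInCell a b =
        ≤-trans (≤-reflexive (sum-cong-≗ (λ w → ≡.sym (⟦∧⟧ (adj G v w) (inCell a b w)))))
                (clique-neighbours G triangleFree (cell-clique a b) v)

    -- Double counting (vertex, cell) incidences, with cells of size ≤ 2.
    cells≤degrees : α * β ≡ numEdges G →
                    ∑[ v < n ] (∣ A R v ∣ * ∣ B R v ∣) ≤ ∑[ v < n ] degree G v
    cells≤degrees αβ≡E = begin
      ∑[ v < n ] (∣ A R v ∣ * ∣ B R v ∣)        ≡⟨ sum-cong-≗ (λ v → card-product (A R v) (B R v)) ⟩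
      ∑[ v < n ] ∑[ a < α ] ∑[ b < β ] ⟦ inCell a b v ⟧
                                                ≡⟨ ∑-comm₃ (λ v a b → ⟦ inCell a b v ⟧) ⟩
      ∑[ a < α ] ∑[ b < β ] count (inCell a b)  ≤⟨ sum-mono (λ a → sum-mono (λ b →
                                                     clique-size G triangleFree (cell-clique a b))) ⟩
      ∑[ a < α ] ∑[ b < β ] 2                   ≡⟨ cong (λ k → ∑[ a < α ] k) (sum-const β 2) ⟩
      ∑[ a < α ] (β * 2)                        ≡⟨ sum-const α (β * 2) ⟩
      α * (β * 2)                               ≡⟨ *-assoc α β 2 ⟨
      α * β * 2                                 ≡⟨ *-comm (α * β) 2 ⟩
      2 * (α * β)                               ≡⟨ cong (2 *_) αβ≡E ⟩
      2 * numEdges G                            ≡⟨ handshake G ⟨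
      ∑[ v < n ] degree G v                     ∎
      where open ≤-Reasoning

lemma5 : (n : ℕ) (G : Graph n) → TriangleFree G →
    (α β : ℕ) → 1 ≤ α → 1 ≤ β → α * β ≡ numEdges G →
    (R : CointersectionRep G α β) →
    ((v : Fin n) → ∣ A R v ∣ * ∣ B R v ∣ ≡ degree G v)
    × ((u v : Fin n) → adj G u v ≡ true →
        (∣ A R u ∩ A R v ∣ ≡ 1) × (∣ B R u ∩ B R v ∣ ≡ 1))
lemma5 n G triangleFree α β _ _ αβ≡E R = cellsEqDegree , edgeSharesOneCell
  where
  open Cells G R

  tight : ∀ v → degree G v ≡ shared v × shared v ≡ ∣ A R v ∣ * ∣ B R v ∣
  tight = sandwich degree≤shared (shared≤cells triangleFree) (cells≤degrees triangleFree αβ≡E)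

  cellsEqDegree : ∀ v → ∣ A R v ∣ * ∣ B R v ∣ ≡ degree G v
  cellsEqDegree v = ≡.sym (trans (proj₁ (tight v)) (proj₂ (tight v)))

  edgeSharesOneCell : ∀ u v → adj G u v ≡ true → (∣ A R u ∩ A R v ∣ ≡ 1) × (∣ B R u ∩ B R v ∣ ≡ 1)
  edgeSharesOneCell u v uv = m*n≡1⇒m≡1 _ _ common≡1 , m*n≡1⇒n≡1 ∣ A R u ∩ A R v ∣ _ common≡1
    where
    common≡1 : common u v ≡ 1
    common≡1 = edge-common-one (proj₁ (tight u)) uv
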